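{- Let $n \geq 2k \geq 4$ be integers and let $\mathcal F, \mathcal G \subset \binom{[n]}{k}$ be non-trivial, cross-intersecting, initial families. For $P \subset [k+1]$ with $2 \leq |P| \leq k$ set $$\alpha(P) = \frac{\left|\mathcal F\left(P, \overline{[k+1]\setminus P}\right)\right|}{\binom{n-k-1}{k-|P|}}, \qquad \beta(P) = \frac{\left|\mathcal G\left(P, \overline{[k+1]\setminus P}\right)\right|}{\binom{n-k-1}{k-|P|}}.$$ If $P, Q \subset [k+1]$ with $2 \leq |P|, |Q| \leq k$ satisfy $P \cap Q = \emptyset$, then $\alpha(P) + \beta(Q) \leq 1$.
   Context: $[n] = \{1,\dots,n\}$, $\binom{[n]}{k}$ is the collection of $k$-element subsets of $[n]$. Families are cross-intersecting if every member of one meets every member of the other; a family is non-trivial if the intersection of all its members is empty. For disjoint sets $A, B$, $\mathcal F(A, \overline B) = \{F \setminus A : A \subset F \in \mathcal F,\ F \cap B = \emptyset\}$. For $k$-sets $A = \{x_1<\dots<x_k\}$, $B = \{y_1<\dots<y_k\}$ write $A \prec B$ if $x_i \leq y_i$ for all $i$; a family is initial if $A \prec B$ and $B$ in the family imply $A$ in the family. -}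

module Defs where

open import Data.Nat using (ℕ; zero; suc; _≤_; _<ᵇ_)
open import Data.Bool using (Bool; true; false; T)
open import Data.Fin using (Fin; toℕ)
open import Data.Fin.Subset using (Subset; _∈_; _∉_; _∩_; _∪_; _─_; ∣_∣; Nonempty; Empty)
open import Data.Fin.Subset.Properties using (_∈?_; nonempty?)
open import Data.List using (List; []; _∷_; map; _++_; filter; length; allFin)
open import Data.List.Relation.Binary.Pointwise using (Pointwise)
open import Data.Vec using ([]; _∷_; tabulate)
open import Data.Product using (Σ; _×_; ∃)
open import Relation.Nullary using (¬_; ¬?)
open import Relation.Nullary.Decidable using (_×-dec_; T?)
open import Relation.Binary.PropositionalEquality using (_≡_)

Family : ℕ → Set
Family n = Subset n → Bool

_∈F_ : ∀ {n} → Subset n → Family n → Set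
A ∈F 𝓕 = T (𝓕 A)

Uniform : ∀ {n} → ℕ → Family n → Set
Uniform k 𝓕 = ∀ A → A ∈F 𝓕 → ∣ A ∣ ≡ k

CrossIntersecting : ∀ {n} → Family n → Family n → Set
CrossIntersecting 𝓕 𝓖 = ∀ F G → F ∈F 𝓕 → G ∈F 𝓖 → Nonempty (F ∩ G)

-- the intersection of all members is empty: every point is missed by some member
NonTrivial : ∀ {n} → Family n → Set
NonTrivial {n} 𝓕 = (x : Fin n) → Σ (Subset n) (λ F → F ∈F 𝓕 × x ∉ F)

elems : ∀ {n} → Subset n → List (Fin n)
elems {n} A = filter (_∈? A) (allFin n)

_≺_ : ∀ {n} → Subset n → Subset n → Set
A ≺ B = Pointwise (λ x y → toℕ x ≤ toℕ y) (elems A) (elems B)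

Initial : ∀ {n} → ℕ → Family n → Set
Initial k 𝓕 = ∀ A B → ∣ A ∣ ≡ k → ∣ B ∣ ≡ k → A ≺ B → B ∈F 𝓕 → A ∈F 𝓕

-- [m] = {1,…,m} as a subset of [n] (Fin index i stands for element i+1)
prefix : ∀ {n} → ℕ → Subset n
prefix m = tabulate (λ i → toℕ i <ᵇ m)

allSubsets : ∀ n → List (Subset n)
allSubsets zero = [] ∷ []
allSubsets (suc n) = map (false ∷_) (allSubsets n) ++ map (true ∷_) (allSubsets n)

Disjoint : ∀ {n} → Subset n → Subset n → Set
Disjoint A B = ¬ Nonempty (A ∩ B)

-- membership in 𝓕(A, B̄) = {F ∖ A : A ⊆ F ∈ 𝓕, F ∩ B = ∅}:
-- H ∈ 𝓕(A, B̄) iff H ∩ A = ∅, H ∪ A ∈ 𝓕 and (H ∪ A) ∩ B = ∅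
InRestr : ∀ {n} → Family n → Subset n → Subset n → Subset n → Set
InRestr 𝓕 A B H = Disjoint H A × ((H ∪ A) ∈F 𝓕 × Disjoint (H ∪ A) B)

restrCount : ∀ {n} → Family n → Subset n → Subset n → ℕ
restrCount {n} 𝓕 A B =
  length (filter (λ H → ¬? (nonempty? (H ∩ A))
                        ×-dec (T? (𝓕 (H ∪ A)) ×-dec ¬? (nonempty? ((H ∪ A) ∩ B))))
                 (allSubsets n))

-- Write K = [k+1], Y = [n] ∖ K, m = |Y| = n − k − 1, and let 𝒜 = 𝓕(P, K∖P) and
-- ℬ = 𝓖(Q, K∖Q), families of a-subsets and b-subsets of Y with a = k − |P| and
-- b = k − |Q|.  Put t = |Q| − 1.  Every t-subset T of a member A of 𝒜 meets every
-- member B of ℬ: otherwise (K∖Q) ∪ T is a k-set lying below A ∪ P in the shifting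
-- order, hence in 𝓕 by initiality, and it is disjoint from B ∪ Q ∈ 𝓖.  So the t-shadow
-- ∂𝒜 of 𝒜 and the t-shadow ∂ℬᶜ of the complements {Y ∖ B : B ∈ ℬ} are disjoint
-- families of t-subsets of Y.  Double counting pairs (set, t-subset) shows that
-- shadows do not decrease normalised sizes: α(P) ≤ |∂𝒜| / C(m,t) and
-- β(Q) ≤ |∂ℬᶜ| / C(m,t).  Adding up gives α(P) + β(Q) ≤ 1.
module Submission where

open import Algebra.Properties.CommutativeSemigroup using (interchange; x∙yz≈y∙xz; xy∙z≈y∙xz)
open import Data.Bool using (true; false; if_then_else_)
open import Data.Empty using (⊥; ⊥-elim)
open import Data.Fin using (Fin; zero; suc; toℕ)
open import Data.Fin.Subset
  using (Subset; outside; inside; _∈_; _∉_; _⊆_; _∩_; _∪_; _─_; ∁; ∣_∣; Nonempty; Empty)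
  renaming (⊥ to ∅)
open import Data.Fin.Subset.Properties
  using ( _∈?_; _⊆?_; nonempty?; anySubset?; drop-there; drop-∷-⊆; drop-∷-Empty
        ; p⊆q⇒∣p∣≤∣q∣; ⊥⊆; ∣⊥∣≡0; p─⊥≡p; ∣∁p∣≡n∸∣p∣; x∉p⇒x∈∁p; x∈∁p⇒x∉p
        ; x∈p∩q⁺; x∈p∩q⁻; x∈p∪q⁺; x∈p∪q⁻; x∈p∧x∉q⇒x∈p─q )
open import Data.List using (List; []; _∷_; _++_; [_]; map; filter; length; tabulate)
open import Data.List.Properties using (++-assoc; length-++; filter-++)
open import Data.List.Relation.Binary.Pointwise using (Pointwise; []; _∷_; map⁻)
import Data.List.Relation.Unary.All as All
open import Data.List.Relation.Unary.All using (All; []; _∷_)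
open import Data.Nat
  using (ℕ; zero; suc; pred; _≤_; _<_; _+_; _*_; _∸_; _!; _≟_; z≤n; s≤s; s≤s⁻¹; >-nonZero; ≢-nonZero⁻¹)
open import Data.Nat.Combinatorics
  using (_C_; nCk≡n!/k![n-k]!; k![n∸k]!∣n!; nCk≡nC[n∸k]; nCk+nC[k+1]≡[n+1]C[k+1])
open import Data.Nat.DivMod using (_/_; m/n*n≡m)
open import Data.Nat.Properties
open import Data.Nat.Tactic.RingSolver using (solve-∀)
open import Data.Product using (_×_; _,_; proj₁; proj₂; ∃-syntax)
open import Data.Sum using (inj₁; inj₂)
open import Data.Vec using ([]; _∷_; here; there; lookup)
open import Function using (_∘_; id; case_of_)
open import Level using (Level; 0ℓ)
open import Relation.Binary.PropositionalEquality
  using (_≡_; refl; sym; trans; cong; cong₂; subst; subst₂; module ≡-Reasoning)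
open import Relation.Nullary using (Dec; yes; no; does; ¬_; ¬?; contradiction)
open import Relation.Nullary.Decidable using (_×-dec_; T?)
open import Relation.Unary using (Pred; Decidable)
open import Defs

private variable
  ℓ : Level
  n m k : ℕ

∑ : (Subset n → ℕ) → ℕ
∑ {zero} f = f []
∑ {suc n} f = ∑ (f ∘ (outside ∷_)) + ∑ (f ∘ (inside ∷_))

∑-zero : ∑ {n} (λ _ → 0) ≡ 0
∑-zero {zero} = refl
∑-zero {suc n} = cong₂ _+_ (∑-zero {n}) (∑-zero {n})

∑-mono-≤ : {f g : Subset n → ℕ} → (∀ X → f X ≤ g X) → ∑ f ≤ ∑ g
∑-mono-≤ {zero} f≤g = f≤g []
∑-mono-≤ {suc n} f≤g = +-mono-≤ (∑-mono-≤ (f≤g ∘ (outside ∷_))) (∑-mono-≤ (f≤g ∘ (inside ∷_)))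

∑-distrib-+ : (f g : Subset n → ℕ) → ∑ (λ X → f X + g X) ≡ ∑ f + ∑ g
∑-distrib-+ {zero} f g = refl
∑-distrib-+ {suc n} f g =
  trans (cong₂ _+_ (∑-distrib-+ (f ∘ (outside ∷_)) (g ∘ (outside ∷_)))
                   (∑-distrib-+ (f ∘ (inside ∷_)) (g ∘ (inside ∷_))))
        (interchange +-commutativeSemigroup
          (∑ (f ∘ (outside ∷_))) (∑ (g ∘ (outside ∷_))) (∑ (f ∘ (inside ∷_))) (∑ (g ∘ (inside ∷_))))

∑-distribʳ-* : (f : Subset n → ℕ) (c : ℕ) → ∑ (λ X → f X * c) ≡ ∑ f * c
∑-distribʳ-* {zero} f c = refl
∑-distribʳ-* {suc n} f c =
  trans (cong₂ _+_ (∑-distribʳ-* (f ∘ (outside ∷_)) c) (∑-distribʳ-* (f ∘ (inside ∷_)) c))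
        (sym (*-distribʳ-+ c (∑ (f ∘ (outside ∷_))) (∑ (f ∘ (inside ∷_)))))

∑-comm : (f : Subset n → Subset m → ℕ) → ∑ (λ X → ∑ (f X)) ≡ ∑ (λ Y → ∑ (λ X → f X Y))
∑-comm {zero} f = refl
∑-comm {suc n} f =
  trans (cong₂ _+_ (∑-comm (f ∘ (outside ∷_))) (∑-comm (f ∘ (inside ∷_))))
        (sym (∑-distrib-+ (λ Y → ∑ (λ X → f (outside ∷ X) Y)) (λ Y → ∑ (λ X → f (inside ∷ X) Y))))

indicator : {A : Set ℓ} → Dec A → ℕ
indicator a? = if does a? then 1 else 0

count : {P : Pred (Subset n) ℓ} → Decidable P → ℕ
count P? = ∑ (indicator ∘ P?)

module _ {P : Pred (Subset n) ℓ} (P? : Decidable P) where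

  count-≡-0 : (∀ X → ¬ P X) → count P? ≡ 0
  count-≡-0 ¬P = n≤0⇒n≡0 (subst (count P? ≤_) (∑-zero {n}) (∑-mono-≤ indicator≤0))
    where
    indicator≤0 : ∀ X → indicator (P? X) ≤ 0
    indicator≤0 X with P? X
    ... | yes p = contradiction p (¬P X)
    ... | no _ = z≤n

  count-mono-≤ : {Q : Pred (Subset n) ℓ} (Q? : Decidable Q) → (∀ {X} → P X → Q X) →
    count P? ≤ count Q?
  count-mono-≤ Q? P⇒Q = ∑-mono-≤ indicator-mono
    where
    indicator-mono : ∀ X → indicator (P? X) ≤ indicator (Q? X)
    indicator-mono X with P? X | Q? X
    ... | yes p | no ¬q = contradiction (P⇒Q p) ¬q
    ... | yes _ | yes _ = ≤-refl
    ... | no _  | _     = z≤n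

  count-disjoint-≤ : {Q R : Pred (Subset n) ℓ} (Q? : Decidable Q) (R? : Decidable R) →
    (∀ {X} → P X → R X) → (∀ {X} → Q X → R X) → (∀ {X} → P X → ¬ Q X) →
    count P? + count Q? ≤ count R?
  count-disjoint-≤ Q? R? P⇒R Q⇒R P⇒¬Q =
    subst (_≤ count R?) (∑-distrib-+ (indicator ∘ P?) (indicator ∘ Q?)) (∑-mono-≤ indicator-sum)
    where
    indicator-sum : ∀ X → indicator (P? X) + indicator (Q? X) ≤ indicator (R? X)
    indicator-sum X with P? X | Q? X | R? X
    ... | yes p | yes q | _     = contradiction q (P⇒¬Q p)
    ... | yes p | no _  | no ¬r = contradiction (P⇒R p) ¬r
    ... | no _  | yes q | no ¬r = contradiction (Q⇒R q) ¬r
    ... | yes _ | no _  | yes _ = ≤-refl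
    ... | no _  | yes _ | yes _ = ≤-refl
    ... | no _  | no _  | _     = z≤n

count-cong : {P Q : Pred (Subset n) ℓ} (P? : Decidable P) (Q? : Decidable Q) →
  (∀ {X} → P X → Q X) → (∀ {X} → Q X → P X) → count P? ≡ count Q?
count-cong P? Q? P⇒Q Q⇒P = ≤-antisym (count-mono-≤ P? Q? P⇒Q) (count-mono-≤ Q? P? Q⇒P)

double-count : {A : Pred (Subset n) ℓ} {B : Pred (Subset m) ℓ} {R : Subset n → Subset m → Set ℓ}
  (A? : Decidable A) (B? : Decidable B) (R? : ∀ X Y → Dec (R X Y)) {dA dB : ℕ} →
  (∀ {X} → A X → dA ≤ count (R? X)) →
  (∀ {Y} → B Y → count (λ X → A? X ×-dec R? X Y) ≤ dB) →
  (∀ {X Y} → A X → R X Y → B Y) →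
  count A? * dA ≤ count B? * dB
double-count A? B? R? {dA} {dB} degree-A degree-B R⇒B = begin
  count A? * dA                             ≡⟨ ∑-distribʳ-* (indicator ∘ A?) dA ⟨
  ∑ (λ X → indicator (A? X) * dA)           ≤⟨ ∑-mono-≤ from-A ⟩
  ∑ (λ X → count (λ Y → A? X ×-dec R? X Y)) ≡⟨ ∑-comm (λ X Y → indicator (A? X ×-dec R? X Y)) ⟩
  ∑ (λ Y → count (λ X → A? X ×-dec R? X Y)) ≤⟨ ∑-mono-≤ into-B ⟩
  ∑ (λ Y → indicator (B? Y) * dB)           ≡⟨ ∑-distribʳ-* (indicator ∘ B?) dB ⟩
  count B? * dB                             ∎
  where
  open ≤-Reasoning
  from-A : ∀ X → indicator (A? X) * dA ≤ count (λ Y → A? X ×-dec R? X Y)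
  from-A X with A? X
  ... | yes a = subst (_≤ count (R? X)) (sym (+-identityʳ dA)) (degree-A a)
  ... | no _ = z≤n
  into-B : ∀ Y → count (λ X → A? X ×-dec R? X Y) ≤ indicator (B? Y) * dB
  into-B Y with B? Y
  ... | yes b = subst (count (λ X → A? X ×-dec R? X Y) ≤_) (sym (+-identityʳ dB)) (degree-B b)
  ... | no ¬b = ≤-reflexive (count-≡-0 (λ X → A? X ×-dec R? X Y) (λ X (a , r) → ¬b (R⇒B a r)))

length-filter-map : {A B : Set} {P : Pred B ℓ} (P? : Decidable P) (g : A → B) (xs : List A) →
  length (filter P? (map g xs)) ≡ length (filter (P? ∘ g) xs)
length-filter-map P? g [] = refl
length-filter-map P? g (x ∷ xs) with does (P? (g x))
... | true = cong suc (length-filter-map P? g xs)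
... | false = length-filter-map P? g xs

length-filter-allSubsets : {P : Pred (Subset n) ℓ} (P? : Decidable P) →
  length (filter P? (allSubsets n)) ≡ count P?
length-filter-allSubsets {zero} P? with does (P? [])
... | true = refl
... | false = refl
length-filter-allSubsets {suc n} P? = begin
  length (filter P? (map (outside ∷_) Xs ++ map (inside ∷_) Xs))
    ≡⟨ cong length (filter-++ P? (map (outside ∷_) Xs) (map (inside ∷_) Xs)) ⟩
  length (filter P? (map (outside ∷_) Xs) ++ filter P? (map (inside ∷_) Xs))
    ≡⟨ length-++ (filter P? (map (outside ∷_) Xs)) ⟩
  length (filter P? (map (outside ∷_) Xs)) + length (filter P? (map (inside ∷_) Xs))
    ≡⟨ cong₂ _+_ (length-filter-map P? (outside ∷_) Xs) (length-filter-map P? (inside ∷_) Xs) ⟩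
  length (filter (P? ∘ (outside ∷_)) Xs) + length (filter (P? ∘ (inside ∷_)) Xs)
    ≡⟨ cong₂ _+_ (length-filter-allSubsets (P? ∘ (outside ∷_)))
                 (length-filter-allSubsets (P? ∘ (inside ∷_))) ⟩
  count P? ∎
  where
  open ≡-Reasoning
  Xs : List (Subset n)
  Xs = allSubsets n

x∈p─q⁻ : ∀ {x : Fin n} (p q : Subset n) → x ∈ p ─ q → x ∈ p × x ∉ q
x∈p─q⁻ (inside ∷ p) (outside ∷ q) here = here , λ ()
x∈p─q⁻ {x = zero} (inside ∷ p) (inside ∷ q) ()
x∈p─q⁻ {x = zero} (outside ∷ p) (inside ∷ q) ()
x∈p─q⁻ {x = zero} (outside ∷ p) (outside ∷ q) ()
x∈p─q⁻ (_ ∷ p) (_ ∷ q) (there x∈p─q) with x∈p─q⁻ p q x∈p─q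
... | x∈p , x∉q = there x∈p , x∉q ∘ drop-there

∣p∪q∣≡∣p∣+∣q∣ : (p q : Subset n) → Empty (p ∩ q) → ∣ p ∪ q ∣ ≡ ∣ p ∣ + ∣ q ∣
∣p∪q∣≡∣p∣+∣q∣ [] [] _ = refl
∣p∪q∣≡∣p∣+∣q∣ (inside ∷ p) (inside ∷ q) p∩q-empty = case p∩q-empty (zero , here) of λ ()
∣p∪q∣≡∣p∣+∣q∣ (inside ∷ p) (outside ∷ q) p∩q-empty =
  cong suc (∣p∪q∣≡∣p∣+∣q∣ p q (drop-∷-Empty p∩q-empty))
∣p∪q∣≡∣p∣+∣q∣ (outside ∷ p) (inside ∷ q) p∩q-empty =
  trans (cong suc (∣p∪q∣≡∣p∣+∣q∣ p q (drop-∷-Empty p∩q-empty))) (sym (+-suc ∣ p ∣ ∣ q ∣))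
∣p∪q∣≡∣p∣+∣q∣ (outside ∷ p) (outside ∷ q) p∩q-empty =
  ∣p∪q∣≡∣p∣+∣q∣ p q (drop-∷-Empty p∩q-empty)

∣p─q∣+∣q∣≡∣p∣ : (p q : Subset n) → q ⊆ p → ∣ p ─ q ∣ + ∣ q ∣ ≡ ∣ p ∣
∣p─q∣+∣q∣≡∣p∣ [] [] _ = refl
∣p─q∣+∣q∣≡∣p∣ (outside ∷ p) (inside ∷ q) q⊆p = case q⊆p here of λ ()
∣p─q∣+∣q∣≡∣p∣ (inside ∷ p) (inside ∷ q) q⊆p =
  trans (+-suc ∣ p ─ q ∣ ∣ q ∣) (cong suc (∣p─q∣+∣q∣≡∣p∣ p q (drop-∷-⊆ q⊆p)))
∣p─q∣+∣q∣≡∣p∣ (inside ∷ p) (outside ∷ q) q⊆p = cong suc (∣p─q∣+∣q∣≡∣p∣ p q (drop-∷-⊆ q⊆p))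
∣p─q∣+∣q∣≡∣p∣ (outside ∷ p) (outside ∷ q) q⊆p = ∣p─q∣+∣q∣≡∣p∣ p q (drop-∷-⊆ q⊆p)

∣p─q∣≡∣p∣∸∣q∣ : (p q : Subset n) → q ⊆ p → ∣ p ─ q ∣ ≡ ∣ p ∣ ∸ ∣ q ∣
∣p─q∣≡∣p∣∸∣q∣ p q q⊆p =
  trans (sym (m+n∸n≡m ∣ p ─ q ∣ ∣ q ∣)) (cong (_∸ ∣ q ∣) (∣p─q∣+∣q∣≡∣p∣ p q q⊆p))

∣prefix[m]∣≡m : m ≤ n → ∣ prefix {n} m ∣ ≡ m
∣prefix[m]∣≡m {zero} {zero} _ = refl
∣prefix[m]∣≡m {zero} {suc n} _ = ∣prefix[m]∣≡m {n = n} z≤n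
∣prefix[m]∣≡m {suc m} {suc n} (s≤s m≤n) = cong suc (∣prefix[m]∣≡m m≤n)

∈prefix⁺ : ∀ {i : Fin n} → toℕ i < m → i ∈ prefix m
∈prefix⁺ {i = zero} (s≤s _) = here
∈prefix⁺ {i = suc i} (s≤s i<m) = there (∈prefix⁺ i<m)

∈prefix⁻ : ∀ {i : Fin n} → i ∈ prefix m → toℕ i < m
∈prefix⁻ {m = suc m} {i = zero} _ = s≤s z≤n
∈prefix⁻ {m = zero} {i = suc i} (there i∈prefix) = case ∈prefix⁻ {m = zero} i∈prefix of λ ()
∈prefix⁻ {m = suc m} {i = suc i} (there i∈prefix) = s≤s (∈prefix⁻ i∈prefix)

∣∁prefix[1+k]∣≡n∸k∸1 : suc k ≤ n → ∣ ∁ (prefix {n} (suc k)) ∣ ≡ n ∸ k ∸ 1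
∣∁prefix[1+k]∣≡n∸k∸1 {k = k} {n = n} 1+k≤n = begin
  ∣ ∁ (prefix {n} (suc k)) ∣   ≡⟨ ∣∁p∣≡n∸∣p∣ (prefix {n} (suc k)) ⟩
  n ∸ ∣ prefix {n} (suc k) ∣   ≡⟨ cong (n ∸_) (∣prefix[m]∣≡m 1+k≤n) ⟩
  n ∸ (1 + k)              ≡⟨ cong (n ∸_) (+-comm 1 k) ⟩
  n ∸ (k + 1)              ≡⟨ ∸-+-assoc n k 1 ⟨
  n ∸ k ∸ 1                ∎
  where open ≡-Reasoning

∣p∣+∣q∣≤∣r∣ : {p q r : Subset n} → Empty (p ∩ q) → p ⊆ r → q ⊆ r → ∣ p ∣ + ∣ q ∣ ≤ ∣ r ∣
∣p∣+∣q∣≤∣r∣ {p = p} {q} p∩q-empty p⊆r q⊆r =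
  subst (_≤ _) (∣p∪q∣≡∣p∣+∣q∣ p q p∩q-empty) (p⊆q⇒∣p∣≤∣q∣ p∪q⊆r)
  where
  p∪q⊆r : p ∪ q ⊆ _
  p∪q⊆r x∈p∪q with x∈p∪q⁻ p q x∈p∪q
  ... | inj₁ x∈p = p⊆r x∈p
  ... | inj₂ x∈q = q⊆r x∈q

between? : (T Z : Subset n) (s : ℕ) → Decidable (λ X → X ⊆ Z × T ⊆ X × ∣ X ∣ ≡ s)
between? T Z s X = X ⊆? Z ×-dec T ⊆? X ×-dec ∣ X ∣ ≟ s

count-between : (T Z : Subset n) (j : ℕ) → T ⊆ Z → count (between? T Z (∣ T ∣ + j)) ≡ ∣ Z ─ T ∣ C j
count-between [] [] zero _ = refl
count-between [] [] (suc j) _ = refl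
count-between (inside ∷ T) (outside ∷ Z) j T⊆Z = case T⊆Z here of λ ()
count-between {suc n} (outside ∷ T) (outside ∷ Z) j T⊆Z =
  trans (cong₂ _+_ (count-between T Z j (drop-∷-⊆ T⊆Z)) (∑-zero {n})) (+-identityʳ (∣ Z ─ T ∣ C j))
count-between (inside ∷ T) (inside ∷ Z) j T⊆Z =
  cong₂ _+_ (count-≡-0 (λ X → between? (inside ∷ T) (inside ∷ Z) (suc (∣ T ∣ + j)) (outside ∷ X))
                       (λ X (_ , T⊆X , _) → case T⊆X here of λ ()))
            (count-between T Z j (drop-∷-⊆ T⊆Z))
count-between (outside ∷ T) (inside ∷ Z) zero T⊆Z =
  cong₂ _+_ (count-between T Z zero (drop-∷-⊆ T⊆Z))
            (count-≡-0 (λ X → between? (outside ∷ T) (inside ∷ Z) (∣ T ∣ + zero) (inside ∷ X)) too-large)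
  where
  too-large : ∀ X → ¬ (inside ∷ X ⊆ inside ∷ Z × outside ∷ T ⊆ inside ∷ X × suc ∣ X ∣ ≡ ∣ T ∣ + zero)
  too-large X (_ , T⊆X , eq) =
    <-irrefl refl (≤-trans (≤-reflexive (trans eq (+-identityʳ ∣ T ∣))) (p⊆q⇒∣p∣≤∣q∣ (drop-∷-⊆ T⊆X)))
count-between (outside ∷ T) (inside ∷ Z) (suc j) T⊆Z = begin
  count (between? T Z (∣ T ∣ + suc j))
    + count (λ X → between? (outside ∷ T) (inside ∷ Z) (∣ T ∣ + suc j) (inside ∷ X))
    ≡⟨ cong (λ s → count (between? T Z (∣ T ∣ + suc j))
                   + count (λ X → between? (outside ∷ T) (inside ∷ Z) s (inside ∷ X)))
            (+-suc ∣ T ∣ j) ⟩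
  count (between? T Z (∣ T ∣ + suc j)) + count (between? T Z (∣ T ∣ + j))
    ≡⟨ cong₂ _+_ (count-between T Z (suc j) T⊆Z′) (count-between T Z j T⊆Z′) ⟩
  ∣ Z ─ T ∣ C suc j + ∣ Z ─ T ∣ C j
    ≡⟨ +-comm (∣ Z ─ T ∣ C suc j) (∣ Z ─ T ∣ C j) ⟩
  ∣ Z ─ T ∣ C j + ∣ Z ─ T ∣ C suc j
    ≡⟨ nCk+nC[k+1]≡[n+1]C[k+1] ∣ Z ─ T ∣ j ⟩
  suc ∣ Z ─ T ∣ C suc j ∎
  where
  open ≡-Reasoning
  T⊆Z′ : T ⊆ Z
  T⊆Z′ = drop-∷-⊆ T⊆Z

count-subsets : (Z : Subset n) (j : ℕ) → count (λ X → X ⊆? Z ×-dec ∣ X ∣ ≟ j) ≡ ∣ Z ∣ C j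
count-subsets {n} Z j = begin
  count (λ X → X ⊆? Z ×-dec ∣ X ∣ ≟ j)
    ≡⟨ count-cong (λ X → X ⊆? Z ×-dec ∣ X ∣ ≟ j) (between? ∅ Z (∣ ∅ {n} ∣ + j))
         (λ (X⊆Z , ∣X∣≡j) → X⊆Z , ⊥⊆ , trans ∣X∣≡j (cong (_+ j) (sym (∣⊥∣≡0 n))))
         (λ (X⊆Z , _ , ∣X∣≡∣∅∣+j) → X⊆Z , trans ∣X∣≡∣∅∣+j (cong (_+ j) (∣⊥∣≡0 n))) ⟩
  count (between? ∅ Z (∣ ∅ {n} ∣ + j))
    ≡⟨ count-between ∅ Z j ⊥⊆ ⟩
  ∣ Z ─ ∅ ∣ C j
    ≡⟨ cong (λ W → ∣ W ∣ C j) (p─⊥≡p Z) ⟩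
  ∣ Z ∣ C j ∎
  where open ≡-Reasoning

[i+j]Ci*i!*j!≡[i+j]! : ∀ i j → ((i + j) C i) * (i ! * j !) ≡ (i + j) !
[i+j]Ci*i!*j!≡[i+j]! i j = begin
  ((i + j) C i) * (i ! * j !)
    ≡⟨ cong (λ d → ((i + j) C i) * (i ! * d !)) (m+n∸m≡n i j) ⟨
  ((i + j) C i) * (i ! * (i + j ∸ i) !)
    ≡⟨ cong (_* (i ! * (i + j ∸ i) !)) (nCk≡n!/k![n-k]! (m≤m+n i j)) ⟩
  ((i + j) ! / (i ! * (i + j ∸ i) !)) * (i ! * (i + j ∸ i) !)
    ≡⟨ m/n*n≡m (k![n∸k]!∣n! (m≤m+n i j)) ⟩
  (i + j) ! ∎
  where
  open ≡-Reasoning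
  instance _ = i !* (i + j ∸ i) !≢0

k≤n⇒0<nCk : k ≤ n → 0 < n C k
k≤n⇒0<nCk {k} k≤n with m≤n⇒∃[o]m+o≡n k≤n
... | j , refl with (k + j) C k | [i+j]Ci*i!*j!≡[i+j]! k j
...   | zero | 0≡[k+j]! = contradiction (sym 0≡[k+j]!) (≢-nonZero⁻¹ ((k + j) !) {{(k + j) !≢0}})
...   | suc _ | _ = s≤s z≤n

[i+j]Ci≡[j+i]Cj : ∀ i j → (i + j) C i ≡ (j + i) C j
[i+j]Ci≡[j+i]Cj i j = begin
  (i + j) C i             ≡⟨ nCk≡nC[n∸k] (m≤m+n i j) ⟩
  (i + j) C (i + j ∸ i)   ≡⟨ cong ((i + j) C_) (m+n∸m≡n i j) ⟩
  (i + j) C j             ≡⟨ cong (_C j) (+-comm i j) ⟩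
  (j + i) C j             ∎
  where open ≡-Reasoning

[x+y+z]C[x+y]*[x+y]Cx≡[x+y+z]Cx*[y+z]Cy : ∀ x y z →
  ((x + y + z) C (x + y)) * ((x + y) C x) ≡ ((x + y + z) C x) * ((y + z) C y)
[x+y+z]C[x+y]*[x+y]Cx≡[x+y+z]Cx*[y+z]Cy x y z =
  *-cancelʳ-≡ _ _ (x ! * (y ! * z !)) {{m*n≢0 _ _ {{x !≢0}} {{y !* z !≢0}}}} (begin
    ((x + y + z) C (x + y)) * ((x + y) C x) * (x ! * (y ! * z !))
      ≡⟨ regroup₁ ((x + y + z) C (x + y)) ((x + y) C x) (x !) (y !) (z !) ⟩
    ((x + y + z) C (x + y)) * ((((x + y) C x) * (x ! * y !)) * z !)
      ≡⟨ cong (λ w → ((x + y + z) C (x + y)) * (w * z !)) ([i+j]Ci*i!*j!≡[i+j]! x y) ⟩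
    ((x + y + z) C (x + y)) * ((x + y) ! * z !)
      ≡⟨ [i+j]Ci*i!*j!≡[i+j]! (x + y) z ⟩
    (x + y + z) !
      ≡⟨ cong _! (+-assoc x y z) ⟩
    (x + (y + z)) !
      ≡⟨ [i+j]Ci*i!*j!≡[i+j]! x (y + z) ⟨
    ((x + (y + z)) C x) * (x ! * (y + z) !)
      ≡⟨ cong (λ w → ((x + (y + z)) C x) * (x ! * w)) ([i+j]Ci*i!*j!≡[i+j]! y z) ⟨
    ((x + (y + z)) C x) * (x ! * (((y + z) C y) * (y ! * z !)))
      ≡⟨ regroup₂ ((x + (y + z)) C x) ((y + z) C y) (x !) (y !) (z !) ⟩
    ((x + (y + z)) C x) * ((y + z) C y) * (x ! * (y ! * z !))
      ≡⟨ cong (λ s → (s C x) * ((y + z) C y) * (x ! * (y ! * z !))) (+-assoc x y z) ⟨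
    ((x + y + z) C x) * ((y + z) C y) * (x ! * (y ! * z !)) ∎)
  where
  open ≡-Reasoning
  regroup₁ : ∀ c d u v w → c * d * (u * (v * w)) ≡ c * ((d * (u * v)) * w)
  regroup₁ = solve-∀
  regroup₂ : ∀ c d u v w → c * (u * (d * (v * w))) ≡ c * d * (u * (v * w))
  regroup₂ = solve-∀

x+y+z∸x≡y+z : ∀ x y z → x + y + z ∸ x ≡ y + z
x+y+z∸x≡y+z x y z = trans (cong (_∸ x) (+-assoc x y z)) (m+n∸m≡n x (y + z))

[m]Ca*[a]Ct≡[m]Ct*[m∸t]C[a∸t] : ∀ {m a t} → t ≤ a → a ≤ m →
  (m C a) * (a C t) ≡ (m C t) * ((m ∸ t) C (a ∸ t))
[m]Ca*[a]Ct≡[m]Ct*[m∸t]C[a∸t] {t = t} t≤a a≤m with m≤n⇒∃[o]m+o≡n t≤a | m≤n⇒∃[o]m+o≡n a≤m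
... | j , refl | l , refl = begin
  ((t + j + l) C (t + j)) * ((t + j) C t)
    ≡⟨ [x+y+z]C[x+y]*[x+y]Cx≡[x+y+z]Cx*[y+z]Cy t j l ⟩
  ((t + j + l) C t) * ((j + l) C j)
    ≡⟨ cong₂ (λ u v → ((t + j + l) C t) * (u C v)) (x+y+z∸x≡y+z t j l) (m+n∸m≡n t j) ⟨
  ((t + j + l) C t) * ((t + j + l ∸ t) C (t + j ∸ t)) ∎
  where open ≡-Reasoning

[m]Cb*[m∸b]Ct≡[m]Ct*[m∸t]Cb : ∀ {m b t} → b + t ≤ m →
  (m C b) * ((m ∸ b) C t) ≡ (m C t) * ((m ∸ t) C b)
[m]Cb*[m∸b]Ct≡[m]Ct*[m∸t]Cb {b = b} {t} b+t≤m with m≤n⇒∃[o]m+o≡n b+t≤m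
... | e , refl = begin
  ((b + t + e) C b) * ((b + t + e ∸ b) C t)
    ≡⟨ cong (λ u → ((b + t + e) C b) * (u C t)) (x+y+z∸x≡y+z b t e) ⟩
  ((b + t + e) C b) * ((t + e) C t)
    ≡⟨ [x+y+z]C[x+y]*[x+y]Cx≡[x+y+z]Cx*[y+z]Cy b t e ⟨
  ((b + t + e) C (b + t)) * ((b + t) C b)
    ≡⟨ cong₂ _*_ (cong₂ _C_ b+t+e≡t+b+e (+-comm b t)) ([i+j]Ci≡[j+i]Cj b t) ⟩
  ((t + b + e) C (t + b)) * ((t + b) C t)
    ≡⟨ [x+y+z]C[x+y]*[x+y]Cx≡[x+y+z]Cx*[y+z]Cy t b e ⟩
  ((t + b + e) C t) * ((b + e) C b)
    ≡⟨ cong₂ (λ u v → (u C t) * (v C b)) b+t+e≡t+b+e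
             (trans (cong (_∸ t) b+t+e≡t+b+e) (x+y+z∸x≡y+z t b e)) ⟨
  ((b + t + e) C t) * ((b + t + e ∸ t) C b) ∎
  where
  open ≡-Reasoning
  b+t+e≡t+b+e : b + t + e ≡ t + b + e
  b+t+e≡t+b+e = cong (_+ e) (+-comm b t)

-- Scanning the positions from left to right, Dominates c A B says that c plus the
-- number of elements of A seen so far never falls below the number of elements of B,
-- and the two counts agree at the end.  For c = 0 this is exactly A ≺ B.
Dominates : ℕ → Subset n → Subset n → Set
Dominates c [] [] = c ≡ 0
Dominates c (inside ∷ A) (outside ∷ B) = Dominates (suc c) A B
Dominates c (inside ∷ A) (inside ∷ B) = Dominates c A B
Dominates c (outside ∷ A) (outside ∷ B) = Dominates c A B
Dominates zero (outside ∷ A) (inside ∷ B) = ⊥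
Dominates (suc c) (outside ∷ A) (inside ∷ B) = Dominates c A B

private
  below-tail : ∀ {t x y} {A B : Subset n} → (∀ {i} → i ∈ x ∷ A → i ∉ y ∷ B → toℕ i < t) →
    ∀ {i} → i ∈ A → i ∉ B → toℕ i < pred t
  below-tail below i∈A i∉B = pred-mono-≤ (below (there i∈A) (i∉B ∘ drop-there))

  above-tail : ∀ {t x y} {A B : Subset n} → (∀ {i} → i ∈ y ∷ B → i ∉ x ∷ A → t ≤ toℕ i) →
    ∀ {i} → i ∈ B → i ∉ A → pred t ≤ toℕ i
  above-tail above i∈B i∉A = pred-mono-≤ (above (there i∈B) (i∉A ∘ drop-there))

dominates-by-threshold : ∀ c t (A B : Subset n) →
  (∀ {i} → i ∈ A → i ∉ B → toℕ i < t) → (∀ {i} → i ∈ B → i ∉ A → t ≤ toℕ i) →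
  c + ∣ A ∣ ≡ ∣ B ∣ → Dominates c A B
dominates-by-threshold c t [] [] _ _ c+0≡0 = trans (sym (+-identityʳ c)) c+0≡0
dominates-by-threshold c t (inside ∷ A) (outside ∷ B) below above eq =
  dominates-by-threshold (suc c) (pred t) A B (below-tail below) (above-tail above)
    (trans (sym (+-suc c ∣ A ∣)) eq)
dominates-by-threshold c t (inside ∷ A) (inside ∷ B) below above eq =
  dominates-by-threshold c (pred t) A B (below-tail below) (above-tail above)
    (suc-injective (trans (sym (+-suc c ∣ A ∣)) eq))
dominates-by-threshold c t (outside ∷ A) (outside ∷ B) below above eq =
  dominates-by-threshold c (pred t) A B (below-tail below) (above-tail above) eq
dominates-by-threshold c (suc t) (outside ∷ A) (inside ∷ B) _ above _ = case above here (λ ()) of λ ()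
dominates-by-threshold zero zero (outside ∷ A) (inside ∷ B) below above eq =
  <-irrefl refl (≤-trans (≤-reflexive (sym eq)) (p⊆q⇒∣p∣≤∣q∣ A⊆B))
  where
  A⊆B : A ⊆ B
  A⊆B {i} i∈A with i ∈? B
  ... | yes i∈B = i∈B
  ... | no i∉B = case below (there i∈A) (i∉B ∘ drop-there) of λ ()
dominates-by-threshold (suc c) zero (outside ∷ A) (inside ∷ B) below above eq =
  dominates-by-threshold c zero A B (λ i∈A i∉B → case below (there i∈A) (i∉B ∘ drop-there) of λ ())
                                    (λ _ _ → z≤n) (suc-injective eq)

positions : ℕ → Subset n → List ℕ
positions o [] = []
positions o (inside ∷ A) = o ∷ positions (suc o) A
positions o (outside ∷ A) = positions (suc o) A

private
  All-≤-suc : ∀ {o} {xs : List ℕ} → All (_≤ o) xs → All (_≤ suc o) xs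
  All-≤-suc = All.map m≤n⇒m≤1+n

  All-≤-snoc : ∀ {o} {xs : List ℕ} → All (_≤ o) xs → All (_≤ suc o) (xs ++ [ o ])
  All-≤-snoc [] = n≤1+n _ ∷ []
  All-≤-snoc (x≤o ∷ xs≤o) = m≤n⇒m≤1+n x≤o ∷ All-≤-snoc xs≤o

-- xs are the pending elements of A, not yet matched by an element of B
dominates⇒pointwise : ∀ o (xs : List ℕ) (A B : Subset n) → All (_≤ o) xs →
  Dominates (length xs) A B → Pointwise _≤_ (xs ++ positions o A) (positions o B)

match-later : ∀ o (xs : List ℕ) (A B : Subset n) → All (_≤ o) xs →
  Dominates (suc (length xs)) A B → Pointwise _≤_ (xs ++ o ∷ positions (suc o) A) (positions (suc o) B)
match-later o xs A B xs≤o dom =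
  subst (λ ys → Pointwise _≤_ ys (positions (suc o) B)) (++-assoc xs [ o ] (positions (suc o) A))
    (dominates⇒pointwise (suc o) (xs ++ [ o ]) A B (All-≤-snoc xs≤o)
      (subst (λ c → Dominates c A B) (sym (trans (length-++ xs) (+-comm (length xs) 1))) dom))

dominates⇒pointwise o [] [] [] _ _ = []
dominates⇒pointwise o (_ ∷ _) [] [] _ ()
dominates⇒pointwise o xs (inside ∷ A) (outside ∷ B) xs≤o dom = match-later o xs A B xs≤o dom
dominates⇒pointwise o [] (inside ∷ A) (inside ∷ B) _ dom =
  ≤-refl ∷ dominates⇒pointwise (suc o) [] A B [] dom
dominates⇒pointwise o (x ∷ xs) (inside ∷ A) (inside ∷ B) (x≤o ∷ xs≤o) dom =
  x≤o ∷ match-later o xs A B xs≤o dom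
dominates⇒pointwise o xs (outside ∷ A) (outside ∷ B) xs≤o dom =
  dominates⇒pointwise (suc o) xs A B (All-≤-suc xs≤o) dom
dominates⇒pointwise o [] (outside ∷ A) (inside ∷ B) _ ()
dominates⇒pointwise o (x ∷ xs) (outside ∷ A) (inside ∷ B) (x≤o ∷ xs≤o) dom =
  x≤o ∷ dominates⇒pointwise (suc o) xs A B (All-≤-suc xs≤o) dom

map-toℕ-filter-tabulate : ∀ {m} (B : Subset m) (A : Subset n) (g : Fin n → Fin m) o →
  (∀ i → toℕ (g i) ≡ o + toℕ i) → (∀ i → does (g i ∈? B) ≡ lookup A i) →
  map toℕ (filter (_∈? B) (tabulate g)) ≡ positions o A
map-toℕ-filter-tabulate B [] g o _ _ = refl
map-toℕ-filter-tabulate B (_ ∷ A) g o g-shift g∈B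
  with map-toℕ-filter-tabulate B A (g ∘ suc) (suc o)
         (λ i → trans (g-shift (suc i)) (+-suc o (toℕ i))) (g∈B ∘ suc)
     | g zero ∈? B | g∈B zero
... | tail≡ | yes _ | refl = cong₂ _∷_ (trans (g-shift zero) (+-identityʳ o)) tail≡
... | tail≡ | no _  | refl = tail≡

map-toℕ-elems : (A : Subset n) → map toℕ (elems A) ≡ positions 0 A
map-toℕ-elems A = map-toℕ-filter-tabulate A A id 0 (λ _ → refl) (does-∈? A)
  where
  does-∈? : ∀ {n} (A : Subset n) i → does (i ∈? A) ≡ lookup A i
  does-∈? (inside ∷ A) zero = refl
  does-∈? (outside ∷ A) zero = refl
  does-∈? (_ ∷ A) (suc i) = does-∈? A i

≺-by-threshold : ∀ t (A B : Subset n) →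
  (∀ {i} → i ∈ A → i ∉ B → toℕ i < t) → (∀ {i} → i ∈ B → i ∉ A → t ≤ toℕ i) →
  ∣ A ∣ ≡ ∣ B ∣ → A ≺ B
≺-by-threshold t A B below above ∣A∣≡∣B∣ =
  map⁻ toℕ toℕ (subst₂ (Pointwise _≤_) (sym (map-toℕ-elems A)) (sym (map-toℕ-elems B))
    (dominates⇒pointwise 0 [] A B [] (dominates-by-threshold 0 t A B below above ∣A∣≡∣B∣)))

Shadow : ℕ → Pred (Subset n) 0ℓ → Pred (Subset n) 0ℓ
Shadow t 𝒜 T = ∃[ X ] 𝒜 X × T ⊆ X × ∣ T ∣ ≡ t

shadow? : ∀ {𝒜 : Pred (Subset n) 0ℓ} t → Decidable 𝒜 → Decidable (Shadow t 𝒜)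
shadow? t 𝒜? T = anySubset? (λ X → 𝒜? X ×-dec T ⊆? X ×-dec ∣ T ∣ ≟ t)

CoShadow : Subset n → ℕ → Pred (Subset n) 0ℓ → Pred (Subset n) 0ℓ
CoShadow Y t ℬ T = ∃[ X ] ℬ X × T ⊆ Y ─ X × ∣ T ∣ ≡ t

coShadow? : ∀ {ℬ : Pred (Subset n) 0ℓ} Y t → Decidable ℬ → Decidable (CoShadow Y t ℬ)
coShadow? Y t ℬ? T = anySubset? (λ X → ℬ? X ×-dec T ⊆? Y ─ X ×-dec ∣ T ∣ ≟ t)

module _ {𝒜 : Pred (Subset n) 0ℓ} (𝒜? : Decidable 𝒜) (Y : Subset n) {a : ℕ}
         (𝒜-uniform : ∀ {X} → 𝒜 X → X ⊆ Y × ∣ X ∣ ≡ a) where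

  shadow-bound : ∀ {t} → t ≤ a →
    count 𝒜? * (a C t) ≤ count (shadow? t 𝒜?) * ((∣ Y ∣ ∸ t) C (a ∸ t))
  shadow-bound {t} t≤a = double-count 𝒜? (shadow? t 𝒜?) (λ X T → T ⊆? X ×-dec ∣ T ∣ ≟ t)
    degree-of-set degree-of-shadow (λ {X} 𝒜X T-in-X → X , 𝒜X , T-in-X)
    where
    degree-of-set : ∀ {X} → 𝒜 X → a C t ≤ count (λ T → T ⊆? X ×-dec ∣ T ∣ ≟ t)
    degree-of-set {X} 𝒜X =
      ≤-reflexive (sym (trans (count-subsets X t) (cong (_C t) (proj₂ (𝒜-uniform 𝒜X)))))

    degree-of-shadow : ∀ {T} → Shadow t 𝒜 T →
      count (λ X → 𝒜? X ×-dec T ⊆? X ×-dec ∣ T ∣ ≟ t) ≤ (∣ Y ∣ ∸ t) C (a ∸ t)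
    degree-of-shadow {T} (X₀ , 𝒜X₀ , T⊆X₀ , ∣T∣≡t) = begin
      count (λ X → 𝒜? X ×-dec T ⊆? X ×-dec ∣ T ∣ ≟ t)
        ≤⟨ count-mono-≤ (λ X → 𝒜? X ×-dec T ⊆? X ×-dec ∣ T ∣ ≟ t)
                        (between? T Y (∣ T ∣ + (a ∸ t))) between ⟩
      count (between? T Y (∣ T ∣ + (a ∸ t)))
        ≡⟨ count-between T Y (a ∸ t) T⊆Y ⟩
      ∣ Y ─ T ∣ C (a ∸ t)
        ≡⟨ cong (_C (a ∸ t)) (trans (∣p─q∣≡∣p∣∸∣q∣ Y T T⊆Y) (cong (∣ Y ∣ ∸_) ∣T∣≡t)) ⟩
      (∣ Y ∣ ∸ t) C (a ∸ t) ∎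
      where
      open ≤-Reasoning
      T⊆Y : T ⊆ Y
      T⊆Y = proj₁ (𝒜-uniform 𝒜X₀) ∘ T⊆X₀
      between : ∀ {X} → 𝒜 X × T ⊆ X × ∣ T ∣ ≡ t → X ⊆ Y × T ⊆ X × ∣ X ∣ ≡ ∣ T ∣ + (a ∸ t)
      between (𝒜X , T⊆X , _) with 𝒜-uniform 𝒜X
      ... | X⊆Y , ∣X∣≡a =
        X⊆Y , T⊆X , trans ∣X∣≡a (trans (sym (m+[n∸m]≡n t≤a)) (cong (_+ (a ∸ t)) (sym ∣T∣≡t)))

module _ {ℬ : Pred (Subset n) 0ℓ} (ℬ? : Decidable ℬ) (Y : Subset n) {b : ℕ}
         (ℬ-uniform : ∀ {X} → ℬ X → X ⊆ Y × ∣ X ∣ ≡ b) where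

  coShadow-bound : ∀ t →
    count ℬ? * ((∣ Y ∣ ∸ b) C t) ≤ count (coShadow? Y t ℬ?) * ((∣ Y ∣ ∸ t) C b)
  coShadow-bound t = double-count ℬ? (coShadow? Y t ℬ?) (λ X T → T ⊆? Y ─ X ×-dec ∣ T ∣ ≟ t)
    degree-of-set degree-of-shadow (λ {X} ℬX T-off-X → X , ℬX , T-off-X)
    where
    degree-of-set : ∀ {X} → ℬ X → (∣ Y ∣ ∸ b) C t ≤ count (λ T → T ⊆? Y ─ X ×-dec ∣ T ∣ ≟ t)
    degree-of-set {X} ℬX with ℬ-uniform ℬX
    ... | X⊆Y , ∣X∣≡b = ≤-reflexive (sym (trans (count-subsets (Y ─ X) t)
                          (cong (_C t) (trans (∣p─q∣≡∣p∣∸∣q∣ Y X X⊆Y) (cong (∣ Y ∣ ∸_) ∣X∣≡b)))))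

    degree-of-shadow : ∀ {T} → CoShadow Y t ℬ T →
      count (λ X → ℬ? X ×-dec T ⊆? Y ─ X ×-dec ∣ T ∣ ≟ t) ≤ (∣ Y ∣ ∸ t) C b
    degree-of-shadow {T} (X₀ , _ , T⊆Y─X₀ , ∣T∣≡t) = begin
      count (λ X → ℬ? X ×-dec T ⊆? Y ─ X ×-dec ∣ T ∣ ≟ t)
        ≤⟨ count-mono-≤ (λ X → ℬ? X ×-dec T ⊆? Y ─ X ×-dec ∣ T ∣ ≟ t)
                        (λ X → X ⊆? Y ─ T ×-dec ∣ X ∣ ≟ b) off-T ⟩
      count (λ X → X ⊆? Y ─ T ×-dec ∣ X ∣ ≟ b)
        ≡⟨ count-subsets (Y ─ T) b ⟩
      ∣ Y ─ T ∣ C b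
        ≡⟨ cong (_C b) (trans (∣p─q∣≡∣p∣∸∣q∣ Y T T⊆Y) (cong (∣ Y ∣ ∸_) ∣T∣≡t)) ⟩
      (∣ Y ∣ ∸ t) C b ∎
      where
      open ≤-Reasoning
      T⊆Y : T ⊆ Y
      T⊆Y = proj₁ ∘ x∈p─q⁻ Y X₀ ∘ T⊆Y─X₀
      off-T : ∀ {X} → ℬ X × T ⊆ Y ─ X × ∣ T ∣ ≡ t → X ⊆ Y ─ T × ∣ X ∣ ≡ b
      off-T (ℬX , T⊆Y─X , _) with ℬ-uniform ℬX
      ... | X⊆Y , ∣X∣≡b =
        (λ x∈X → x∈p∧x∉q⇒x∈p─q (X⊆Y x∈X) (λ x∈T → proj₂ (x∈p─q⁻ Y _ (T⊆Y─X x∈T)) x∈X)) , ∣X∣≡b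

-- p / P ≤ s / K with denominators cleared: p / P = p c / (K u) ≤ s u / (K u)
ratio-≤ : ∀ p P s K {c u} → 0 < c → p * c ≤ s * u → P * c ≡ K * u → p * K ≤ s * P
ratio-≤ p P s K {suc c} {u} _ pc≤su Pc≡Ku = *-cancelʳ-≤ (p * K) (s * P) (suc c) (begin
  p * K * suc c   ≡⟨ xy∙z≈y∙xz *-commutativeSemigroup p K (suc c) ⟩
  K * (p * suc c) ≤⟨ *-monoʳ-≤ K pc≤su ⟩
  K * (s * u)     ≡⟨ x∙yz≈y∙xz *-commutativeSemigroup K s u ⟩
  s * (K * u)     ≡⟨ cong (s *_) Pc≡Ku ⟨
  s * (P * suc c) ≡⟨ *-assoc s P (suc c) ⟨
  s * P * suc c   ∎)
  where
  open ≤-Reasoning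

-- p / P + q / Q ≤ s / K + s′ / K ≤ 1 with denominators cleared
ratios-sum-≤ : ∀ p P q Q s s′ {K} → 0 < K → p * K ≤ s * P → q * K ≤ s′ * Q → s + s′ ≤ K →
  p * Q + q * P ≤ P * Q
ratios-sum-≤ p P q Q s s′ {suc K} _ pK≤sP qK≤s′Q s+s′≤K =
  *-cancelʳ-≤ (p * Q + q * P) (P * Q) (suc K) (begin
  (p * Q + q * P) * suc K            ≡⟨ distribute p Q q P (suc K) ⟩
  (p * suc K) * Q + (q * suc K) * P  ≤⟨ +-mono-≤ (*-monoˡ-≤ Q pK≤sP) (*-monoˡ-≤ P qK≤s′Q) ⟩
  (s * P) * Q + (s′ * Q) * P         ≡⟨ collect s P Q s′ ⟩
  (s + s′) * (P * Q)                 ≤⟨ *-monoˡ-≤ (P * Q) s+s′≤K ⟩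
  suc K * (P * Q)                    ≡⟨ *-comm (suc K) (P * Q) ⟩
  P * Q * suc K                      ∎)
  where
  open ≤-Reasoning
  distribute : ∀ p Q q P K → (p * Q + q * P) * K ≡ (p * K) * Q + (q * K) * P
  distribute = solve-∀
  collect : ∀ s P Q s′ → (s * P) * Q + (s′ * Q) * P ≡ (s + s′) * (P * Q)
  collect = solve-∀

module _ {𝒜 ℬ : Pred (Subset n) 0ℓ} (𝒜? : Decidable 𝒜) (ℬ? : Decidable ℬ) (Y : Subset n) {a b t : ℕ}
         (𝒜-uniform : ∀ {X} → 𝒜 X → X ⊆ Y × ∣ X ∣ ≡ a)
         (ℬ-uniform : ∀ {X} → ℬ X → X ⊆ Y × ∣ X ∣ ≡ b) where

  cross-shadow-bound : ∀ {m} → ∣ Y ∣ ≡ m → t ≤ a → a ≤ m → b + t ≤ m →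
    (∀ {A B T} → 𝒜 A → ℬ B → T ⊆ A → ∣ T ∣ ≡ t → Nonempty (T ∩ B)) →
    count 𝒜? * (m C b) + count ℬ? * (m C a) ≤ (m C a) * (m C b)
  cross-shadow-bound {m} refl t≤a a≤m b+t≤m t-sets-meet =
    ratios-sum-≤ #𝒜 (m C a) #ℬ (m C b) #∂𝒜 #∂ℬ (k≤n⇒0<nCk (≤-trans t≤a a≤m)) α-bound β-bound shadows-≤
    where
    #𝒜 #ℬ #∂𝒜 #∂ℬ : ℕ
    #𝒜 = count 𝒜?
    #ℬ = count ℬ?
    #∂𝒜 = count (shadow? t 𝒜?)
    #∂ℬ = count (coShadow? Y t ℬ?)
    α-bound : #𝒜 * (m C t) ≤ #∂𝒜 * (m C a)
    α-bound = ratio-≤ #𝒜 (m C a) #∂𝒜 (m C t) (k≤n⇒0<nCk t≤a) (shadow-bound 𝒜? Y 𝒜-uniform t≤a)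
                      ([m]Ca*[a]Ct≡[m]Ct*[m∸t]C[a∸t] t≤a a≤m)
    β-bound : #ℬ * (m C t) ≤ #∂ℬ * (m C b)
    β-bound = ratio-≤ #ℬ (m C b) #∂ℬ (m C t)
                      (k≤n⇒0<nCk (m+n≤o⇒m≤o∸n t (subst (_≤ m) (+-comm b t) b+t≤m)))
                      (coShadow-bound ℬ? Y ℬ-uniform t) ([m]Cb*[m∸b]Ct≡[m]Ct*[m∸t]Cb {b = b} {t} b+t≤m)
    disjoint-shadows : ∀ {T} → Shadow t 𝒜 T → ¬ CoShadow Y t ℬ T
    disjoint-shadows (A , 𝒜A , T⊆A , ∣T∣≡t) (B , ℬB , T⊆Y─B , _) with t-sets-meet 𝒜A ℬB T⊆A ∣T∣≡t
    ... | x , x∈T∩B with x∈p∩q⁻ _ B x∈T∩B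
    ...   | x∈T , x∈B = proj₂ (x∈p─q⁻ Y B (T⊆Y─B x∈T)) x∈B
    shadows-≤ : #∂𝒜 + #∂ℬ ≤ m C t
    shadows-≤ = ≤-trans
      (count-disjoint-≤ (shadow? t 𝒜?) (coShadow? Y t ℬ?) (λ T → T ⊆? Y ×-dec ∣ T ∣ ≟ t)
        (λ (A , 𝒜A , T⊆A , ∣T∣≡t) → proj₁ (𝒜-uniform 𝒜A) ∘ T⊆A , ∣T∣≡t)
        (λ (B , _ , T⊆Y─B , ∣T∣≡t) → proj₁ ∘ x∈p─q⁻ Y B ∘ T⊆Y─B , ∣T∣≡t)
        disjoint-shadows)
      (≤-reflexive (count-subsets Y t))

inRestr? : (𝓕 : Family n) (A B : Subset n) → Decidable (InRestr 𝓕 A B)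
inRestr? 𝓕 A B H = ¬? (nonempty? (H ∩ A)) ×-dec (T? (𝓕 (H ∪ A)) ×-dec ¬? (nonempty? ((H ∪ A) ∩ B)))

restrCount≡count : (𝓕 : Family n) (A B : Subset n) → restrCount 𝓕 A B ≡ count (inRestr? 𝓕 A B)
restrCount≡count 𝓕 A B = length-filter-allSubsets (inRestr? 𝓕 A B)

inRestr[K─R]⇒⊆∁K : ∀ 𝓕 {R K H : Subset n} → InRestr 𝓕 R (K ─ R) H → H ⊆ ∁ K
inRestr[K─R]⇒⊆∁K _ {R} (H∩R-empty , _ , [H∪R]∩[K─R]-empty) {x} x∈H =
  x∉p⇒x∈∁p λ x∈K → case x ∈? R of λ where
    (yes x∈R) → H∩R-empty (x , x∈p∩q⁺ (x∈H , x∈R))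
    (no x∉R) → [H∪R]∩[K─R]-empty (x , x∈p∩q⁺ (x∈p∪q⁺ (inj₁ x∈H) , x∈p∧x∉q⇒x∈p─q x∈K x∉R))

inRestr⇒∣∣≡k∸∣∣ : ∀ {k} {𝓕 : Family n} {R B H} → Uniform k 𝓕 → InRestr 𝓕 R B H → ∣ H ∣ ≡ k ∸ ∣ R ∣
inRestr⇒∣∣≡k∸∣∣ {k = k} {R = R} {H = H} uniform (H∩R-empty , H∪R∈𝓕 , _) = begin
  ∣ H ∣                  ≡⟨ m+n∸n≡m ∣ H ∣ ∣ R ∣ ⟨
  ∣ H ∣ + ∣ R ∣ ∸ ∣ R ∣  ≡⟨ cong (_∸ ∣ R ∣) (∣p∪q∣≡∣p∣+∣q∣ H R H∩R-empty) ⟨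
  ∣ H ∪ R ∣ ∸ ∣ R ∣      ≡⟨ cong (_∸ ∣ R ∣) (uniform (H ∪ R) H∪R∈𝓕) ⟩
  k ∸ ∣ R ∣              ∎
  where open ≡-Reasoning

module _ {𝓕 𝓖 : Family n} {P Q A B : Subset n}
         (∣K∣≡1+k : ∣ prefix {n} (suc k) ∣ ≡ suc k) (𝓕-uniform : Uniform k 𝓕) (𝓕-initial : Initial k 𝓕)
         (cross : CrossIntersecting 𝓕 𝓖) (P⊆K : P ⊆ prefix (suc k)) (Q⊆K : Q ⊆ prefix (suc k))
         (P∩Q-empty : Empty (P ∩ Q))
         (A∈𝓕[P,K─P] : InRestr 𝓕 P (prefix (suc k) ─ P) A)
         (B∈𝓖[Q,K─Q] : InRestr 𝓖 Q (prefix (suc k) ─ Q) B) where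

  private
    K : Subset n
    K = prefix (suc k)

  -- (K ─ Q) ∪ T lies below A ∪ P in the shifting order, so it belongs to 𝓕, and it can
  -- meet B ∪ Q only inside T.
  restrictions-t-sets-meet : ∀ {T} → T ⊆ A → suc ∣ T ∣ ≡ ∣ Q ∣ → Nonempty (T ∩ B)
  restrictions-t-sets-meet {T} T⊆A 1+∣T∣≡∣Q∣ =
    meet-inside-T (cross F (B ∪ Q) F∈𝓕 (proj₁ (proj₂ B∈𝓖[Q,K─Q])))
    where
    F : Subset n
    F = (K ─ Q) ∪ T

    A⊆∁K : A ⊆ ∁ K
    A⊆∁K = inRestr[K─R]⇒⊆∁K 𝓕 A∈𝓕[P,K─P]

    ∣F∣≡k : ∣ F ∣ ≡ k
    ∣F∣≡k = begin
      ∣ (K ─ Q) ∪ T ∣          ≡⟨ ∣p∪q∣≡∣p∣+∣q∣ (K ─ Q) T K─Q∩T-empty ⟩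
      ∣ K ─ Q ∣ + ∣ T ∣        ≡⟨ suc-injective (begin
        suc (∣ K ─ Q ∣ + ∣ T ∣)  ≡⟨ +-suc ∣ K ─ Q ∣ ∣ T ∣ ⟨
        ∣ K ─ Q ∣ + suc ∣ T ∣    ≡⟨ cong (∣ K ─ Q ∣ +_) 1+∣T∣≡∣Q∣ ⟩
        ∣ K ─ Q ∣ + ∣ Q ∣        ≡⟨ ∣p─q∣+∣q∣≡∣p∣ K Q Q⊆K ⟩
        ∣ K ∣                    ≡⟨ ∣K∣≡1+k ⟩
        suc k                    ∎) ⟩
      k                        ∎
      where
      open ≡-Reasoning
      K─Q∩T-empty : Empty ((K ─ Q) ∩ T)
      K─Q∩T-empty (x , x∈[K─Q]∩T) with x∈p∩q⁻ (K ─ Q) T x∈[K─Q]∩T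
      ... | x∈K─Q , x∈T = x∈∁p⇒x∉p (A⊆∁K (T⊆A x∈T)) (proj₁ (x∈p─q⁻ K Q x∈K─Q))

    ∣A∪P∣≡k : ∣ A ∪ P ∣ ≡ k
    ∣A∪P∣≡k = 𝓕-uniform (A ∪ P) (proj₁ (proj₂ A∈𝓕[P,K─P]))

    F≺A∪P : F ≺ (A ∪ P)
    F≺A∪P = ≺-by-threshold (suc k) F (A ∪ P) below above (trans ∣F∣≡k (sym ∣A∪P∣≡k))
      where
      below : ∀ {i} → i ∈ F → ¬ i ∈ A ∪ P → toℕ i < suc k
      below {i} i∈F i∉A∪P with x∈p∪q⁻ (K ─ Q) T i∈F
      ... | inj₁ i∈K─Q = ∈prefix⁻ (proj₁ (x∈p─q⁻ K Q i∈K─Q))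
      ... | inj₂ i∈T = ⊥-elim (i∉A∪P (x∈p∪q⁺ (inj₁ (T⊆A i∈T))))
      above : ∀ {i} → i ∈ A ∪ P → ¬ i ∈ F → suc k ≤ toℕ i
      above {i} i∈A∪P i∉F with x∈p∪q⁻ A P i∈A∪P
      ... | inj₁ i∈A = ≮⇒≥ (x∈∁p⇒x∉p (A⊆∁K i∈A) ∘ ∈prefix⁺)
      ... | inj₂ i∈P = ⊥-elim (i∉F (x∈p∪q⁺ (inj₁ (x∈p∧x∉q⇒x∈p─q (P⊆K i∈P) i∉Q))))
        where
        i∉Q : ¬ i ∈ Q
        i∉Q i∈Q = P∩Q-empty (i , x∈p∩q⁺ (i∈P , i∈Q))

    F∈𝓕 : F ∈F 𝓕
    F∈𝓕 = 𝓕-initial F (A ∪ P) ∣F∣≡k ∣A∪P∣≡k F≺A∪P (proj₁ (proj₂ A∈𝓕[P,K─P]))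

    meet-inside-T : Nonempty (F ∩ (B ∪ Q)) → Nonempty (T ∩ B)
    meet-inside-T (x , x∈F∩[B∪Q]) with x∈F , x∈B∪Q ← x∈p∩q⁻ F (B ∪ Q) x∈F∩[B∪Q]
      with x∈p∪q⁻ (K ─ Q) T x∈F | x∈p∪q⁻ B Q x∈B∪Q
    ... | inj₂ x∈T   | inj₁ x∈B = x , x∈p∩q⁺ (x∈T , x∈B)
    ... | inj₁ x∈K─Q | inj₁ x∈B =
      ⊥-elim (x∈∁p⇒x∉p (inRestr[K─R]⇒⊆∁K 𝓖 B∈𝓖[Q,K─Q] x∈B) (proj₁ (x∈p─q⁻ K Q x∈K─Q)))
    ... | inj₁ x∈K─Q | inj₂ x∈Q = ⊥-elim (proj₂ (x∈p─q⁻ K Q x∈K─Q) x∈Q)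
    ... | inj₂ x∈T   | inj₂ x∈Q = ⊥-elim (x∈∁p⇒x∉p (A⊆∁K (T⊆A x∈T)) (Q⊆K x∈Q))

k+k≤n⇐2k≤n : 2 * k ≤ n → k + k ≤ n
k+k≤n⇐2k≤n {k = k} {n = n} = subst (_≤ n) (cong (k +_) (+-identityʳ k))

1+k≤n⇐2k≤n : 1 ≤ k → 2 * k ≤ n → suc k ≤ n
1+k≤n⇐2k≤n {k = k} 1≤k 2k≤n =
  ≤-trans (subst (_≤ k + k) (+-comm k 1) (+-monoʳ-≤ k 1≤k)) (k+k≤n⇐2k≤n {k = k} 2k≤n)

k∸1≤n∸k∸1 : 2 * k ≤ n → k ∸ 1 ≤ n ∸ k ∸ 1
k∸1≤n∸k∸1 {k = k} 2k≤n = ∸-monoˡ-≤ 1 (m+n≤o⇒m≤o∸n k (k+k≤n⇐2k≤n {k = k} 2k≤n))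

pred-q≤k∸p : ∀ {p q} → p + q ≤ suc k → pred q ≤ k ∸ p
pred-q≤k∸p {q = zero} _ = z≤n
pred-q≤k∸p {k} {p} {suc q} p+q≤1+k =
  m+n≤o⇒m≤o∸n q (s≤s⁻¹ (subst (_≤ suc k) (trans (+-suc p q) (cong suc (+-comm p q))) p+q≤1+k))

k∸p≤n∸k∸1 : ∀ {p} → 1 ≤ p → 2 * k ≤ n → k ∸ p ≤ n ∸ k ∸ 1
k∸p≤n∸k∸1 {k} 1≤p 2k≤n = ≤-trans (∸-monoʳ-≤ k 1≤p) (k∸1≤n∸k∸1 {k = k} 2k≤n)

k∸q+pred-q≤n∸k∸1 : ∀ {p q} → 1 ≤ p → 1 ≤ q → p + q ≤ suc k → 2 * k ≤ n → k ∸ q + pred q ≤ n ∸ k ∸ 1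
k∸q+pred-q≤n∸k∸1 {k} {n} {suc p} {suc q} _ _ (s≤s p+1+q≤k) 2k≤n = begin
  k ∸ suc q + q      ≡⟨ cong (_+ q) (∸-+-assoc k 1 q) ⟨
  k ∸ 1 ∸ q + q      ≡⟨ m∸n+n≡m q≤k∸1 ⟩
  k ∸ 1              ≤⟨ k∸1≤n∸k∸1 {k = k} 2k≤n ⟩
  n ∸ k ∸ 1          ∎
  where
  open ≤-Reasoning
  q≤k∸1 : q ≤ k ∸ 1
  q≤k∸1 = m+n≤o⇒m≤o∸n q (subst (_≤ k) (+-comm 1 q) (m+n≤o⇒n≤o p p+1+q≤k))

claim3p1 : (n k : ℕ) → 2 ≤ k → 2 * k ≤ n →
    (𝓕 𝓖 : Family n) →
    Uniform k 𝓕 → Uniform k 𝓖 →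
    NonTrivial 𝓕 → NonTrivial 𝓖 →
    CrossIntersecting 𝓕 𝓖 →
    Initial k 𝓕 → Initial k 𝓖 →
    (P Q : Subset n) →
    P ⊆ prefix (suc k) → Q ⊆ prefix (suc k) →
    2 ≤ ∣ P ∣ → ∣ P ∣ ≤ k → 2 ≤ ∣ Q ∣ → ∣ Q ∣ ≤ k →
    Empty (P ∩ Q) →
    -- α(P) + β(Q) ≤ 1 with denominators cleared (both binomials are positive)
    restrCount 𝓕 P (prefix (suc k) ─ P) * ((n ∸ k ∸ 1) C (k ∸ ∣ Q ∣))
      + restrCount 𝓖 Q (prefix (suc k) ─ Q) * ((n ∸ k ∸ 1) C (k ∸ ∣ P ∣))
      ≤ ((n ∸ k ∸ 1) C (k ∸ ∣ P ∣)) * ((n ∸ k ∸ 1) C (k ∸ ∣ Q ∣))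
claim3p1 n k 2≤k 2k≤n 𝓕 𝓖 𝓕-uniform 𝓖-uniform _ _ cross 𝓕-initial _ P Q P⊆K Q⊆K 2≤∣P∣ _ 2≤∣Q∣ _ P∩Q-empty
  rewrite restrCount≡count 𝓕 P (prefix (suc k) ─ P) | restrCount≡count 𝓖 Q (prefix (suc k) ─ Q) =
  cross-shadow-bound (inRestr? 𝓕 P (K ─ P)) (inRestr? 𝓖 Q (K ─ Q)) (∁ K)
    (λ H∈𝒜 → inRestr[K─R]⇒⊆∁K 𝓕 H∈𝒜 , inRestr⇒∣∣≡k∸∣∣ 𝓕-uniform H∈𝒜)
    (λ H∈ℬ → inRestr[K─R]⇒⊆∁K 𝓖 H∈ℬ , inRestr⇒∣∣≡k∸∣∣ 𝓖-uniform H∈ℬ)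
    (∣∁prefix[1+k]∣≡n∸k∸1 1+k≤n)
    (pred-q≤k∸p {p = ∣ P ∣} ∣P∣+∣Q∣≤1+k) (k∸p≤n∸k∸1 1≤∣P∣ 2k≤n)
    (k∸q+pred-q≤n∸k∸1 1≤∣P∣ 1≤∣Q∣ ∣P∣+∣Q∣≤1+k 2k≤n)
    (λ A∈𝒜 B∈ℬ T⊆A ∣T∣≡t →
      restrictions-t-sets-meet (∣prefix[m]∣≡m 1+k≤n) 𝓕-uniform 𝓕-initial cross P⊆K Q⊆K P∩Q-empty A∈𝒜 B∈ℬ T⊆A
        (trans (cong suc ∣T∣≡t) (suc-pred ∣ Q ∣ {{>-nonZero 1≤∣Q∣}})))
  where
  K : Subset n
  K = prefix (suc k)
  1≤∣P∣ : 1 ≤ ∣ P ∣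
  1≤∣P∣ = ≤-trans (n≤1+n 1) 2≤∣P∣
  1≤∣Q∣ : 1 ≤ ∣ Q ∣
  1≤∣Q∣ = ≤-trans (n≤1+n 1) 2≤∣Q∣
  1+k≤n : suc k ≤ n
  1+k≤n = 1+k≤n⇐2k≤n (≤-trans (n≤1+n 1) 2≤k) 2k≤n
  ∣P∣+∣Q∣≤1+k : ∣ P ∣ + ∣ Q ∣ ≤ suc k
  ∣P∣+∣Q∣≤1+k = subst (∣ P ∣ + ∣ Q ∣ ≤_) (∣prefix[m]∣≡m 1+k≤n) (∣p∣+∣q∣≤∣r∣ P∩Q-empty P⊆K Q⊆K)
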